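{- Let $\mathcal E_8$ be the graph on $8$ vertices consisting of $4$ pairwise disjoint edges. Then $t(\mathcal E_8)=5=t_e(\mathcal E_8)+1$.
   Context: For a finite simple graph $G$, a family of subsets $B_v\subseteq[1,t]=\{1,\dots,t\}$, one for each vertex $v$, is a $G$-ECFF$(t,|V(G)|)$ if for every edge $\{a,b\}$ and every vertex $w\notin\{a,b\}$, $B_w\not\subseteq B_a\cup B_b$; it is a $G$-CFF$(t,|V(G)|)$ if in addition $B_a\not\subseteq B_b$ and $B_b\not\subseteq B_a$ for every edge $\{a,b\}$. $t_e(G)$ and $t(G)$ denote the minimum $t$ for which a $G$-ECFF, respectively a $G$-CFF, on $|V(G)|$ sets exists. -}

module Defs where

open import Data.Nat using (ℕ; _<_; _≤_; _+_; _*_)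
open import Data.Fin using (Fin; toℕ)
open import Data.Fin.Subset using (Subset; _⊆_; _∪_)
open import Data.Nat.DivMod using (_/_)
open import Data.Product using (_×_; Σ; _,_)
open import Relation.Binary.PropositionalEquality using (_≡_; _≢_)
open import Relation.Nullary using (¬_)

record Graph : Set₁ where
  field
    n     : ℕ
    Adj   : Fin n → Fin n → Set
    sym   : ∀ {a b} → Adj a b → Adj b a
    irrfl : ∀ {a} → ¬ Adj a a
open Graph public

Family : Graph → ℕ → Set
Family G t = Fin (n G) → Subset t

IsECFF : (G : Graph) (t : ℕ) → Family G t → Set
IsECFF G t B = ∀ a b w → Adj G a b → w ≢ a → w ≢ b → ¬ (B w ⊆ (B a ∪ B b))

IsCFF : (G : Graph) (t : ℕ) → Family G t → Set
IsCFF G t B = IsECFF G t B × (∀ a b → Adj G a b → ¬ (B a ⊆ B b) × ¬ (B b ⊆ B a))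

HasECFF : Graph → ℕ → Set
HasECFF G t = Σ (Family G t) (IsECFF G t)

HasCFF : Graph → ℕ → Set
HasCFF G t = Σ (Family G t) (IsCFF G t)

IsMinimum : (ℕ → Set) → ℕ → Set
IsMinimum P k = P k × (∀ m → m < k → ¬ P m)

tₑ≡ : Graph → ℕ → Set
tₑ≡ G k = IsMinimum (HasECFF G) k

t≡ : Graph → ℕ → Set
t≡ G k = IsMinimum (HasCFF G) k

-- The graph E_8 on vertices 0..7 with the 4 disjoint edges {2i, 2i+1}:
-- a ~ b iff a ≠ b and ⌊a/2⌋ = ⌊b/2⌋.
E8Adj : Fin 8 → Fin 8 → Set
E8Adj a b = (a ≢ b) × (toℕ a / 2 ≡ toℕ b / 2)

E8 : Graph
E8 = record
  { n = 8
  ; Adj = E8Adj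
  ; sym = λ { (a≢b , e) → (λ p → a≢b (Eq.sym p)) , Eq.sym e }
  ; irrfl = λ { (a≢a , _) → a≢a Eq.refl }
  }
  where import Relation.Binary.PropositionalEquality as Eq

module Submission where

-- Two endpoints of an edge {y, z} may not cover a third vertex, so B x ⊆ B y is impossible
-- whenever x ∉ {y, z}; in a CFF it is impossible for x ≠ y outright.  Hence an ECFF of E8 maps
-- one endpoint of each edge to a 4-element antichain, and a CFF maps all 8 vertices to an
-- antichain.  The power set of [3] is covered by 3 chains and that of [4] by 6, which rules out
-- an ECFF with t = 3 and a CFF with t = 4; adding an unused point shows both properties are
-- monotone in t.  Conversely the singletons {i} on the i-th edge form an ECFF with t = 4, and
-- the 2-subsets of {0,…,4} other than {1,2} and {3,4}, paired so that the union along each edge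
-- contains one of these two missing pairs, form a CFF with t = 5.

open import Defs
open import Data.Nat using (ℕ; _+_)
open import Data.Product using (_×_)

open import Level using (Level)
open import Data.Bool using (true; false)
open import Data.Fin as Fin using (Fin; quotient)
open import Data.Fin.Patterns
import Data.Fin.Properties as Finₚ
open import Data.Fin.Subset using (Subset; _⊆_; _∪_; ⁅_⁆; outside)
open import Data.Fin.Subset.Properties using (_⊆?_; p⊆p∪q; drop-∷-⊆; anySubset?)
open import Data.Nat as ℕ using (suc; _≤_; _≤′_; ≤′-refl; ≤′-step)
import Data.Nat.Properties as ℕₚ
open import Data.Product using (Σ; ∃; _,_; proj₁; proj₂)
open import Data.Sum using (_⊎_; [_,_]′)
open import Data.Vec using ([]; _∷_)
open import Function using (_∘_)
open import Relation.Binary.PropositionalEquality using (_≡_; _≢_; refl; subst) renaming (sym to ≡-sym)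
open import Relation.Nullary using (¬_; Dec; yes; no)
open import Relation.Nullary.Decidable using (¬?; _×-dec_; _⊎-dec_; _→-dec_; from-yes; from-no; decidable-stable)
open import Relation.Unary using (Pred; Decidable)

private
  variable
    ℓ : Level
    k m t : ℕ

allSubset? : {P : Pred (Subset t) ℓ} → Decidable P → Dec (∀ p → P p)
allSubset? P? with anySubset? (¬? ∘ P?)
... | yes (p , ¬Pp) = no λ ∀P → ¬Pp (∀P p)
... | no ∄¬P = yes λ p → decidable-stable (P? p) (λ ¬Pp → ∄¬P (p , ¬Pp))

Antichain : (Fin k → Subset t) → Set
Antichain f = ∀ i j → i ≢ j → ¬ (f i ⊆ f j)

ChainCover : ℕ → ℕ → Set
ChainCover t m = Σ (Subset t → Fin m) λ c → ∀ x y → c x ≡ c y → x ⊆ y ⊎ y ⊆ x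

chainCover? : (c : Subset t → Fin m) → Dec (∀ x y → c x ≡ c y → x ⊆ y ⊎ y ⊆ x)
chainCover? c = allSubset? λ x → allSubset? λ y →
  (c x Fin.≟ c y) →-dec (x ⊆? y ⊎-dec y ⊆? x)

antichain≤chainCover : ChainCover t m → (f : Fin k → Subset t) → Antichain f → k ≤ m
antichain≤chainCover (c , comparable) f antichain = ℕₚ.≮⇒≥ λ m<k →
  let i , j , i<j , ci≡cj = Finₚ.pigeonhole m<k (c ∘ f)
  in [ antichain i j (Finₚ.<⇒≢ i<j) , antichain j i (Finₚ.<⇒≢ i<j ∘ ≡-sym) ]′
       (comparable (f i) (f j) ci≡cj)

chainCover₃ : ChainCover 3 3
chainCover₃ = chain , from-yes (chainCover? chain)
  where
    chain : Subset 3 → Fin 3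
    chain (false ∷ true  ∷ false ∷ []) = 1F
    chain (false ∷ true  ∷ true  ∷ []) = 1F
    chain (false ∷ false ∷ true  ∷ []) = 2F
    chain (true  ∷ false ∷ true  ∷ []) = 2F
    chain _                            = 0F

chainCover₄ : ChainCover 4 6
chainCover₄ = chain , from-yes (chainCover? chain)
  where
    chain : Subset 4 → Fin 6
    chain (false ∷ true  ∷ false ∷ false ∷ []) = 1F
    chain (false ∷ true  ∷ true  ∷ false ∷ []) = 1F
    chain (false ∷ true  ∷ true  ∷ true  ∷ []) = 1F
    chain (false ∷ false ∷ true  ∷ false ∷ []) = 2F
    chain (true  ∷ false ∷ true  ∷ false ∷ []) = 2F
    chain (true  ∷ false ∷ true  ∷ true  ∷ []) = 2F
    chain (false ∷ false ∷ false ∷ true  ∷ []) = 3F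
    chain (true  ∷ false ∷ false ∷ true  ∷ []) = 3F
    chain (true  ∷ true  ∷ false ∷ true  ∷ []) = 3F
    chain (false ∷ true  ∷ false ∷ true  ∷ []) = 4F
    chain (false ∷ false ∷ true  ∷ true  ∷ []) = 5F
    chain _                                    = 0F

NoIsolatedVertex : Graph → Set
NoIsolatedVertex G = ∀ v → ∃ (Adj G v)

IndependentFamily : (G : Graph) → (Fin k → Fin (n G)) → Set
IndependentFamily G vs = ∀ i j → i ≢ j → vs i ≢ vs j × ¬ Adj G (vs i) (vs j)

module _ {G : Graph} {B : Family G t} where

  ecff-incomparable : IsECFF G t B → ∀ {x y z} → Adj G y z → x ≢ y → x ≢ z → ¬ (B x ⊆ B y)
  ecff-incomparable ecff {x} {y} {z} y~z x≢y x≢z Bx⊆By =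
    ecff y z x y~z x≢y x≢z (p⊆p∪q (B z) ∘ Bx⊆By)

  cff-incomparable : IsCFF G t B → ∀ {x y z} → Adj G y z → x ≢ y → ¬ (B x ⊆ B y)
  cff-incomparable (ecff , incomparable) {x} {y} {z} y~z x≢y with x Fin.≟ z
  ... | yes refl = proj₂ (incomparable y x y~z)
  ... | no x≢z   = ecff-incomparable ecff y~z x≢y x≢z

  ecff-independent-antichain : IsECFF G t B → NoIsolatedVertex G →
    (vs : Fin k → Fin (n G)) → IndependentFamily G vs → Antichain (B ∘ vs)
  ecff-independent-antichain ecff neighbour vs independent i j i≢j =
    ecff-incomparable ecff vsj~z vsi≢vsj vsi≢z
    where
      z = proj₁ (neighbour (vs j))
      vsj~z = proj₂ (neighbour (vs j))
      vsi≢vsj = proj₁ (independent i j i≢j)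
      vsi≢z : vs i ≢ z
      vsi≢z vsi≡z = proj₂ (independent j i (i≢j ∘ ≡-sym)) (subst (Adj G (vs j)) (≡-sym vsi≡z) vsj~z)

  cff-antichain : IsCFF G t B → NoIsolatedVertex G → Antichain B
  cff-antichain cff neighbour x y x≢y = cff-incomparable cff (proj₂ (neighbour y)) x≢y

  ecff-suc : IsECFF G t B → IsECFF G (suc t) ((outside ∷_) ∘ B)
  ecff-suc ecff a b w a~b w≢a w≢b = ecff a b w a~b w≢a w≢b ∘ drop-∷-⊆

  cff-suc : IsCFF G t B → IsCFF G (suc t) ((outside ∷_) ∘ B)
  cff-suc (ecff , incomparable) = ecff-suc ecff , λ a b a~b →
    let a⋢b , b⋢a = incomparable a b a~b in a⋢b ∘ drop-∷-⊆ , b⋢a ∘ drop-∷-⊆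

hasECFF-mono : ∀ {G s} → t ≤′ s → HasECFF G t → HasECFF G s
hasECFF-mono ≤′-refl h = h
hasECFF-mono {G = G} (≤′-step t≤s) h with B , ecff ← hasECFF-mono {G = G} t≤s h =
  (outside ∷_) ∘ B , ecff-suc {G = G} {B = B} ecff

hasCFF-mono : ∀ {G s} → t ≤′ s → HasCFF G t → HasCFF G s
hasCFF-mono ≤′-refl h = h
hasCFF-mono {G = G} (≤′-step t≤s) h with B , cff ← hasCFF-mono {G = G} t≤s h =
  (outside ∷_) ∘ B , cff-suc {G = G} {B = B} cff

module _ (G : Graph) (adj? : ∀ a b → Dec (Adj G a b)) where

  isECFF? : (B : Family G t) → Dec (IsECFF G t B)
  isECFF? B = Finₚ.all? λ a → Finₚ.all? λ b → Finₚ.all? λ w →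
    adj? a b →-dec ¬? (w Fin.≟ a) →-dec ¬? (w Fin.≟ b) →-dec ¬? (B w ⊆? (B a ∪ B b))

  isCFF? : (B : Family G t) → Dec (IsCFF G t B)
  isCFF? B = isECFF? B ×-dec (Finₚ.all? λ a → Finₚ.all? λ b →
    adj? a b →-dec (¬? (B a ⊆? B b) ×-dec ¬? (B b ⊆? B a)))

E8Adj? : ∀ a b → Dec (E8Adj a b)
E8Adj? a b = ¬? (a Fin.≟ b) ×-dec (Fin.toℕ a ℕ./ 2 ℕ.≟ Fin.toℕ b ℕ./ 2)

E8-neighbour : NoIsolatedVertex E8
E8-neighbour = from-yes (Finₚ.all? λ v → Finₚ.any? (E8Adj? v))

evens : Fin 4 → Fin 8
evens i = Fin.combine {n = 2} i 0F

evens-independent : IndependentFamily E8 evens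
evens-independent = from-yes (Finₚ.all? λ i → Finₚ.all? λ j →
  ¬? (i Fin.≟ j) →-dec (¬? (evens i Fin.≟ evens j) ×-dec ¬? (E8Adj? (evens i) (evens j))))

¬HasECFF-E8-3 : ¬ HasECFF E8 3
¬HasECFF-E8-3 (B , ecff) = from-no (4 ℕ.≤? 3)
  (antichain≤chainCover chainCover₃ (B ∘ evens)
    (ecff-independent-antichain {G = E8} {B = B} ecff E8-neighbour evens evens-independent))

¬HasCFF-E8-4 : ¬ HasCFF E8 4
¬HasCFF-E8-4 (B , cff) = from-no (8 ℕ.≤? 6)
  (antichain≤chainCover chainCover₄ B (cff-antichain {G = E8} {B = B} cff E8-neighbour))

edgeSingletons : Family E8 4
edgeSingletons v = ⁅ quotient 2 v ⁆

pairFamily : Family E8 5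
pairFamily 0F = ⁅ 0F ⁆ ∪ ⁅ 1F ⁆
pairFamily 1F = ⁅ 0F ⁆ ∪ ⁅ 2F ⁆
pairFamily 2F = ⁅ 0F ⁆ ∪ ⁅ 3F ⁆
pairFamily 3F = ⁅ 0F ⁆ ∪ ⁅ 4F ⁆
pairFamily 4F = ⁅ 1F ⁆ ∪ ⁅ 3F ⁆
pairFamily 5F = ⁅ 2F ⁆ ∪ ⁅ 3F ⁆
pairFamily 6F = ⁅ 1F ⁆ ∪ ⁅ 4F ⁆
pairFamily 7F = ⁅ 2F ⁆ ∪ ⁅ 4F ⁆

proposition5p11 : t≡ E8 5 × tₑ≡ E8 4
proposition5p11 =
    ((pairFamily , from-yes (isCFF? E8 E8Adj? pairFamily)) ,
     λ m m<5 → ¬HasCFF-E8-4 ∘ hasCFF-mono {G = E8} (ℕₚ.≤⇒≤′ (ℕ.s≤s⁻¹ m<5)))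
  , ((edgeSingletons , from-yes (isECFF? E8 E8Adj? edgeSingletons)) ,
     λ m m<4 → ¬HasECFF-E8-3 ∘ hasECFF-mono {G = E8} (ℕₚ.≤⇒≤′ (ℕ.s≤s⁻¹ m<4)))
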